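{- Let $T$ be a text. For every string $S$ that is not branching in $T$, the net frequency satisfies $\phi(S)=0$.
   Context: A string $S$ is branching in $T$ if $S$ is the longest common prefix of two distinct suffixes of $T$. With $f(W)$ the number of occurrences of $W$ in $T$ (length $n$), an occurrence $(s,e)$ is a net occurrence if $f(T[s\ldots e])\ge 2$, $f(T[s-1\ldots e])=1$ and $f(T[s\ldots e+1])=1$, where the second condition is considered true when $s=1$ and the third when $e=n$. The net frequency $\phi(S)$ is the number of net occurrences $(s,e)$ with $T[s\ldots e]=S$. -}

module Defs where

open import Data.Nat using (ℕ; zero; suc; _+_; _∸_; _≤_; _<_; _≤?_)
import Data.Nat as ℕ
open import Data.List using (List; []; _∷_; length; take; drop; filter; upTo; concatMap; map)
open import Data.List.Properties using (≡-dec)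
open import Data.Product using (_×_; _,_; ∃-syntax)
open import Data.Product.Properties using () 
open import Data.Sum using (_⊎_)
open import Relation.Nullary using (¬_; Dec; yes; no)
open import Relation.Nullary.Decidable using (_×-dec_; _⊎-dec_)
open import Relation.Binary.Definitions using (DecidableEquality)
open import Relation.Binary.PropositionalEquality using (_≡_)

-- Strings over an alphabet A with decidable equality are lists.
-- Positions are 0-based: a text T of length n has positions 0 … n-1.

-- T[s … e] (0-based, inclusive), i.e. the substring of length e+1-s starting at s.
substr : {A : Set} → List A → ℕ → ℕ → List A
substr T s e = take (suc e ∸ s) (drop s T)

OccursAt : {A : Set} → List A → List A → ℕ → Set
OccursAt T W i = (i + length W ≤ length T) × (substr T i (i + length W ∸ 1) ≡ W)

occursAt? : {A : Set} → DecidableEquality A → (T W : List A) → (i : ℕ) → Dec (OccursAt T W i)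
occursAt? _≟_ T W i = (i + length W ≤? length T) ×-dec ≡-dec _≟_ (substr T i (i + length W ∸ 1)) W

freq : {A : Set} → DecidableEquality A → List A → List A → ℕ
freq _≟_ T W = length (filter (occursAt? _≟_ T W) (upTo (length T)))

NetOcc : {A : Set} → DecidableEquality A → List A → ℕ → ℕ → Set
NetOcc _≟_ T s e =
  (s ≤ e) × (e < length T)
  × (2 ≤ freq _≟_ T (substr T s e))
  × ((s ≡ 0) ⊎ (freq _≟_ T (substr T (s ∸ 1) e) ≡ 1))
  × ((suc e ≡ length T) ⊎ (freq _≟_ T (substr T s (suc e)) ≡ 1))

netOcc? : {A : Set} (_≟_ : DecidableEquality A) (T : List A) (s e : ℕ) → Dec (NetOcc _≟_ T s e)
netOcc? _≟_ T s e =
  (s ≤? e) ×-dec (suc e ≤? length T)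
  ×-dec (2 ≤? freq _≟_ T (substr T s e))
  ×-dec ((s ℕ.≟ 0) ⊎-dec (freq _≟_ T (substr T (s ∸ 1) e) ℕ.≟ 1))
  ×-dec ((suc e ℕ.≟ length T) ⊎-dec (freq _≟_ T (substr T s (suc e)) ℕ.≟ 1))

pairs : ℕ → List (ℕ × ℕ)
pairs n = concatMap (λ s → map (λ e → (s , e)) (upTo n)) (upTo n)

netFreq : {A : Set} → DecidableEquality A → List A → List A → ℕ
netFreq _≟_ T S =
  length (filter (λ p → netOcc? _≟_ T (Data.Product.proj₁ p) (Data.Product.proj₂ p)
                         ×-dec ≡-dec _≟_ (substr T (Data.Product.proj₁ p) (Data.Product.proj₂ p)) S)
                 (pairs (length T)))
  where import Data.Product

lcp : {A : Set} → DecidableEquality A → List A → List A → List A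
lcp _≟_ [] _ = []
lcp _≟_ (_ ∷ _) [] = []
lcp _≟_ (x ∷ xs) (y ∷ ys) with x ≟ y
... | yes _ = x ∷ lcp _≟_ xs ys
... | no _ = []

Branching : {A : Set} → DecidableEquality A → List A → List A → Set
Branching _≟_ T S =
  ∃[ i ] ∃[ j ] (i < length T) × (j < length T) × (¬ i ≡ j)
    × (lcp _≟_ (drop i T) (drop j T) ≡ S)

-- A net occurrence (s,e) of W = T[s…e] has a second occurrence of W at some j ≠ s,
-- since f(W) ≥ 2. If the letters following these two occurrences were equal to some c,
-- then Wc would occur twice, contradicting f(T[s…e+1]) = 1; when e = n-1 there is no
-- following letter at s at all. Hence lcp(T[s…], T[j…]) = W and W is branching.
module Submission where

open import Defs
open import Data.Empty using (⊥; ⊥-elim)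
open import Data.List using (List; []; _∷_; [_]; _++_; length; take; drop; filter; upTo)
open import Data.List.Membership.Propositional using (_∈_)
open import Data.List.Membership.Propositional.Properties using (∈-upTo⁺; ∈-filter⁺; ∈-filter⁻)
open import Data.List.Properties
  using (take++drop≡id; take-[]; drop-drop; drop-all; length-take; length-drop; length-++-≤ˡ; length-++-sucʳ; ++-assoc; ++-identityʳ; filter-none)
open import Data.List.Relation.Unary.All using (_∷_; universal)
open import Data.List.Relation.Unary.AllPairs using (_∷_)
open import Data.List.Relation.Unary.Any using (here; there)
open import Data.List.Relation.Unary.Unique.Propositional using (Unique)
open import Data.List.Relation.Unary.Unique.Propositional.Properties using (upTo⁺; filter⁺)
open import Data.Nat using (zero; suc; _+_; _∸_; _≤_; _<_; z≤n; s≤s)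
import Data.Nat as ℕ
open import Data.Nat.Properties
open import Data.Product using (_×_; _,_; proj₁; proj₂; ∃-syntax)
open import Data.Sum using (_⊎_; inj₁; inj₂)
open import Function using (_∘_)
open import Relation.Nullary using (¬_; yes; no)
open import Relation.Binary.Definitions using (DecidableEquality)
open import Relation.Binary.PropositionalEquality
  using (_≡_; _≢_; refl; sym; trans; cong; cong₂; subst; module ≡-Reasoning)

open ≡-Reasoning

module _ {A : Set} where

  take-+ : ∀ m n (xs : List A) → take (m + n) xs ≡ take m xs ++ take n (drop m xs)
  take-+ zero    n xs       = refl
  take-+ (suc m) n []       = sym (take-[] n)
  take-+ (suc m) n (x ∷ xs) = cong (x ∷_) (take-+ m n xs)

  take-length-++ : ∀ (xs ys : List A) → take (length xs) (xs ++ ys) ≡ xs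
  take-length-++ []       ys = refl
  take-length-++ (x ∷ xs) ys = cong (x ∷_) (take-length-++ xs ys)

  drop-drop-∸ : ∀ {m n} → m ≤ n → (xs : List A) → drop (n ∸ m) (drop m xs) ≡ drop n xs
  drop-drop-∸ {m} m≤n xs = trans (drop-drop m _ xs) (cong (λ k → drop k xs) (m+[n∸m]≡n m≤n))

  +-length-drop : ∀ i (xs : List A) → 0 < length (drop i xs) → i + length (drop i xs) ≡ length xs
  +-length-drop zero    xs       _ = refl
  +-length-drop (suc i) (x ∷ xs) h = cong suc (+-length-drop i xs h)

  0<length-++-[x] : ∀ (xs : List A) x → 0 < length (xs ++ [ x ])
  0<length-++-[x] xs x = subst (0 <_) (sym (length-++-sucʳ xs x [])) (s≤s z≤n)

  ∈⇒0<length : ∀ {x : A} {xs} → x ∈ xs → 0 < length xs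
  ∈⇒0<length (here _)  = s≤s z≤n
  ∈⇒0<length (there _) = s≤s z≤n

  ∈-∈-≢⇒2≤length : ∀ {x y : A} {xs} → x ∈ xs → y ∈ xs → x ≢ y → 2 ≤ length xs
  ∈-∈-≢⇒2≤length (here refl) (here refl) x≢y = ⊥-elim (x≢y refl)
  ∈-∈-≢⇒2≤length (here _)    (there y∈)  _   = s≤s (∈⇒0<length y∈)
  ∈-∈-≢⇒2≤length (there x∈)  _           _   = s≤s (∈⇒0<length x∈)

  unique-2≤length⇒∃∈-≢ : DecidableEquality A → ∀ {xs} → Unique xs → 2 ≤ length xs →
                         ∀ z → ∃[ x ] x ∈ xs × x ≢ z
  unique-2≤length⇒∃∈-≢ _≟_ {x ∷ y ∷ _} ((x≢y ∷ _) ∷ _) _ z with x ≟ z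
  ... | no x≢z   = x , here refl , x≢z
  ... | yes refl = y , there (here refl) , x≢y ∘ sym
  unique-2≤length⇒∃∈-≢ _ {_ ∷ []} _ (s≤s ())

module _ {A : Set} (T : List A) where

  length-substr : ∀ s {e} → e < length T → length (substr T s e) ≡ suc e ∸ s
  length-substr s {e} e<n = trans (length-take (suc e ∸ s) (drop s T))
    (m≤n⇒m⊓n≡m (subst (suc e ∸ s ≤_) (sym (length-drop s T)) (∸-monoˡ-≤ s e<n)))

  substr-nonempty : ∀ {s e} → s ≤ e → e < length T → 0 < length (substr T s e)
  substr-nonempty {s} s≤e e<n = subst (0 <_) (sym (length-substr s e<n)) (m<n⇒0<n∸m (s≤s s≤e))

  drop≡substr++drop : ∀ {s e} → s ≤ suc e → drop s T ≡ substr T s e ++ drop (suc e) T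
  drop≡substr++drop {s} {e} s≤1+e = begin
    drop s T                                       ≡⟨ sym (take++drop≡id (suc e ∸ s) (drop s T)) ⟩
    substr T s e ++ drop (suc e ∸ s) (drop s T)   ≡⟨ cong (substr T s e ++_) (drop-drop-∸ s≤1+e T) ⟩
    substr T s e ++ drop (suc e) T                 ∎

  substr-suc : ∀ {s e} → s ≤ suc e → substr T s (suc e) ≡ substr T s e ++ take 1 (drop (suc e) T)
  substr-suc {s} {e} s≤1+e = begin
    take (suc (suc e) ∸ s) (drop s T)
      ≡⟨ cong (λ k → take k (drop s T)) (trans (+-∸-assoc 1 s≤1+e) (+-comm 1 (suc e ∸ s))) ⟩
    take (suc e ∸ s + 1) (drop s T)
      ≡⟨ take-+ (suc e ∸ s) 1 (drop s T) ⟩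
    substr T s e ++ take 1 (drop (suc e ∸ s) (drop s T))
      ≡⟨ cong (λ xs → substr T s e ++ take 1 xs) (drop-drop-∸ s≤1+e T) ⟩
    substr T s e ++ take 1 (drop (suc e) T) ∎

  -- The inclusive end index i + |W| ∸ 1 describes a window of width |W| only for nonempty W.
  substr-occurrence : ∀ i (W : List A) → 0 < length W →
                      substr T i (i + length W ∸ 1) ≡ take (length W) (drop i T)
  substr-occurrence i W 0<|W| = cong (λ k → take k (drop i T)) (width (length W) 0<|W|)
    where
    width : ∀ n → 0 < n → suc (i + n ∸ 1) ∸ i ≡ n
    width (suc l) _ = begin
      suc (i + suc l ∸ 1) ∸ i  ≡⟨ cong (λ k → suc (k ∸ 1) ∸ i) (+-suc i l) ⟩
      suc (i + l) ∸ i          ≡⟨ cong (_∸ i) (sym (+-suc i l)) ⟩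
      i + suc l ∸ i            ≡⟨ m+n∸m≡n i (suc l) ⟩
      suc l                    ∎

  occursAt⇒drop≡++ : ∀ {i W} → 0 < length W → OccursAt T W i →
                     drop i T ≡ W ++ drop (length W) (drop i T)
  occursAt⇒drop≡++ {i} {W} 0<|W| (_ , W≡) = begin
    drop i T
      ≡⟨ sym (take++drop≡id (length W) (drop i T)) ⟩
    take (length W) (drop i T) ++ drop (length W) (drop i T)
      ≡⟨ cong (_++ drop (length W) (drop i T)) (trans (sym (substr-occurrence i W 0<|W|)) W≡) ⟩
    W ++ drop (length W) (drop i T) ∎

  occursAt⇒< : ∀ {i W} → 0 < length W → OccursAt T W i → i < length T
  occursAt⇒< {i} 0<|W| (fits , _) = ≤-trans (m<m+n i 0<|W|) fits

  drop≡++⇒occursAt : ∀ {i W r} → 0 < length W → drop i T ≡ W ++ r → OccursAt T W i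
  drop≡++⇒occursAt {i} {W} {r} 0<|W| eq = fits , (begin
    substr T i (i + length W ∸ 1)  ≡⟨ substr-occurrence i W 0<|W| ⟩
    take (length W) (drop i T)     ≡⟨ cong (take (length W)) eq ⟩
    take (length W) (W ++ r)       ≡⟨ take-length-++ W r ⟩
    W                              ∎)
    where
    |W|≤|drop| : length W ≤ length (drop i T)
    |W|≤|drop| = subst (length W ≤_) (cong length (sym eq)) (length-++-≤ˡ W)

    fits : i + length W ≤ length T
    fits = ≤-trans (+-monoʳ-≤ i |W|≤|drop|)
                   (≤-reflexive (+-length-drop i T (≤-trans 0<|W| |W|≤|drop|)))

module _ {A : Set} (_≟_ : DecidableEquality A) where

  lcp-++ : ∀ (W xs ys : List A) → lcp _≟_ (W ++ xs) (W ++ ys) ≡ W ++ lcp _≟_ xs ys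
  lcp-++ []      xs ys = refl
  lcp-++ (w ∷ W) xs ys with w ≟ w
  ... | yes _  = cong (w ∷_) (lcp-++ W xs ys)
  ... | no w≢w = ⊥-elim (w≢w refl)

  lcp-distinct-heads : ∀ {xs ys : List A} → (∀ {c r r′} → xs ≡ c ∷ r → ys ≡ c ∷ r′ → ⊥) →
                       lcp _≟_ xs ys ≡ []
  lcp-distinct-heads {[]}              _ = refl
  lcp-distinct-heads {_ ∷ _} {[]}      _ = refl
  lcp-distinct-heads {x ∷ _} {y ∷ _} common with x ≟ y
  ... | yes refl = ⊥-elim (common refl refl)
  ... | no _     = refl

  module _ (T : List A) where

    freq≥2 : ∀ {W i j} → 0 < length W → i ≢ j → OccursAt T W i → OccursAt T W j → 2 ≤ freq _≟_ T W
    freq≥2 {W} 0<|W| i≢j occI occJ = ∈-∈-≢⇒2≤length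
      (∈-filter⁺ (occursAt? _≟_ T W) (∈-upTo⁺ (occursAt⇒< T 0<|W| occI)) occI)
      (∈-filter⁺ (occursAt? _≟_ T W) (∈-upTo⁺ (occursAt⇒< T 0<|W| occJ)) occJ) i≢j

    freq≥2⇒occursAt-elsewhere : ∀ W → 2 ≤ freq _≟_ T W → ∀ s → ∃[ j ] OccursAt T W j × j ≢ s
    freq≥2⇒occursAt-elsewhere W twice s
      with j , j∈ , j≢s ← unique-2≤length⇒∃∈-≢ ℕ._≟_
                            (filter⁺ (occursAt? _≟_ T W) (upTo⁺ (length T))) twice s
      = j , proj₂ (∈-filter⁻ (occursAt? _≟_ T W) {xs = upTo (length T)} j∈) , j≢s

    unique-extension⇒lcp≡ : ∀ {W i j ri rj} → i ≢ j → drop i T ≡ W ++ ri → drop j T ≡ W ++ rj →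
                            (∀ {c r} → ri ≡ c ∷ r → freq _≟_ T (W ++ [ c ]) ≡ 1) →
                            lcp _≟_ (drop i T) (drop j T) ≡ W
    unique-extension⇒lcp≡ {W} {i} {j} {ri} {rj} i≢j dropI dropJ unique = begin
      lcp _≟_ (drop i T) (drop j T)  ≡⟨ cong₂ (lcp _≟_) dropI dropJ ⟩
      lcp _≟_ (W ++ ri) (W ++ rj)    ≡⟨ lcp-++ W ri rj ⟩
      W ++ lcp _≟_ ri rj             ≡⟨ cong (W ++_) (lcp-distinct-heads no-common-head) ⟩
      W ++ []                        ≡⟨ ++-identityʳ W ⟩
      W                              ∎
      where
      extension-occurs : ∀ {k c r} → drop k T ≡ W ++ c ∷ r → OccursAt T (W ++ [ c ]) k
      extension-occurs {c = c} {r} eq =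
        drop≡++⇒occursAt T (0<length-++-[x] W c)
                           (trans eq (sym (++-assoc W [ c ] r)))

      no-common-head : ∀ {c r r′} → ri ≡ c ∷ r → rj ≡ c ∷ r′ → ⊥
      no-common-head {c} ri≡ rj≡ with s≤s () ← subst (2 ≤_) (unique ri≡)
        (freq≥2 (0<length-++-[x] W c) i≢j
                (extension-occurs (trans dropI (cong (W ++_) ri≡)))
                (extension-occurs (trans dropJ (cong (W ++_) rj≡))))

    netOcc⇒branching : ∀ {s e} → NetOcc _≟_ T s e → Branching _≟_ T (substr T s e)
    netOcc⇒branching {s} {e} (s≤e , e<n , twice , _ , rightMaximal)
      with j , occJ , j≢s ← freq≥2⇒occursAt-elsewhere (substr T s e) twice s
      = s , j , ≤-<-trans s≤e e<n , occursAt⇒< T 0<|W| occJ , s≢j ,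
        unique-extension⇒lcp≡ s≢j (drop≡substr++drop T s≤1+e) (occursAt⇒drop≡++ T 0<|W| occJ)
                              (unique-extension rightMaximal)
      where
      W = substr T s e
      s≢j = j≢s ∘ sym
      s≤1+e = m≤n⇒m≤1+n s≤e

      0<|W| : 0 < length W
      0<|W| = substr-nonempty T s≤e e<n

      unique-extension : (suc e ≡ length T) ⊎ (freq _≟_ T (substr T s (suc e)) ≡ 1) →
                         ∀ {c r} → drop (suc e) T ≡ c ∷ r → freq _≟_ T (W ++ [ c ]) ≡ 1
      unique-extension (inj₁ 1+e≡n) rs≡ with () ← trans (sym rs≡) (drop-all (suc e) T (≤-reflexive (sym 1+e≡n)))
      unique-extension (inj₂ once)  rs≡ =
        subst (λ V → freq _≟_ T V ≡ 1) (trans (substr-suc T s≤1+e) (cong (λ xs → W ++ take 1 xs) rs≡)) once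

lemma18 : {A : Set} (_≟_ : DecidableEquality A) (T S : List A) →
          ¬ Branching _≟_ T S → netFreq _≟_ T S ≡ 0
lemma18 _≟_ T S nonBranching = cong length (filter-none _ (universal notNetOccOfS (pairs (length T))))
  where
  notNetOccOfS : ∀ p → ¬ (NetOcc _≟_ T (proj₁ p) (proj₂ p) × substr T (proj₁ p) (proj₂ p) ≡ S)
  notNetOccOfS (s , e) (net , refl) = nonBranching (netOcc⇒branching _≟_ T net)
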